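{- Let $R$ be an eDCTRS over a signature $\mathcal{F}$ (where $\mathbb{U}(R)$ and $\mathbb{U}_{\mathrm{opt}}(R)$ use the same U symbols $U^\rho_i$). (a) If $\mathbb{U}_{\mathrm{opt}}$ is sound for $R$, then $\mathbb{U}$ is sound for $R$. (b) If $\mathbb{U}_{\mathrm{opt}}$ is sound for $R$ with respect to EV-safe reduction of $\mathbb{U}_{\mathrm{opt}}(R)$, then $\mathbb{U}$ is sound for $R$ with respect to EV-safe reduction of $\mathbb{U}(R)$.
   Context: Terms $T(\mathcal{F},\mathcal{V})$ over a signature $\mathcal{F}$ and countably infinite variable set $\mathcal{V}$; $\mathrm{Var}(\cdot)$ the variables occurring; $\mathrm{Pos}_{\mathcal{F}}(t)$ and $\mathrm{Pos}_{\mathcal{V}}(t)$ the positions of function symbols and of variables in $t$; $t|_p$ the subterm at $p$; $p\le q$ means $p$ is a prefix of $q$. An extended conditional rule is $\rho: l\to r\Leftarrow s_1\twoheadrightarrow t_1;\dots;s_k\twoheadrightarrow t_k$ ($k\ge0$, $l$ may be a variable); an eCTRS is a set of such rules, an eTRS one with only unconditional rules (extra variables allowed). Rewrite relation of an eCTRS: $\to_R=\bigcup_n\to_{(n),R}$ with $\to_{(0),R}=\emptyset$ and $\to_{(i+1),R}=\{(C[l\sigma],C[r\sigma])\mid s_j\sigma\to^*_{(i),R}t_j\sigma\ \forall j\}$. Deterministic rule: $\mathrm{Var}(s_i)\subseteq\mathrm{Var}(l,t_1,\dots,t_{i-1})$ for all $i$; eDCTRS: all rules deterministic. Unravelings: for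 a deterministic rule $\rho$ with $k\ge1$ let $X_i=\mathrm{Var}(l,t_1,\dots,t_{i-1})$, $Y_i=\mathrm{Var}(r,t_i,s_{i+1},t_{i+1},\dots,s_k,t_k)$, $Z_i=X_i\cap Y_i$; $\overrightarrow{X}$ lists a finite set $X$ in a fixed order; $U^\rho_1,\dots,U^\rho_k$ are fresh symbols. $\mathbb{U}(\rho)=\{l\to U^\rho_1(s_1,\overrightarrow{X_1})\}\cup\{U^\rho_i(t_i,\overrightarrow{X_i})\to U^\rho_{i+1}(s_{i+1},\overrightarrow{X_{i+1}})\mid 1\le i<k\}\cup\{U^\rho_k(t_k,\overrightarrow{X_k})\to r\}$ and $\mathbb{U}_{\mathrm{opt}}(\rho)$ is the same with $Z_i$ in place of $X_i$; for unconditional $\rho$ both give $\{\rho\}$; both are extended to eDCTRSs by union. EV-safe reduction: for an eTRS $S$ and a reduction sequence $t_0\to_{p_1,\rho_1}t_1\to_{p_2,\rho_2}\cdots$ with $\rho_i:l_i\to r_i\in S$ applied at position $p_i$, put $B_0=\mathrm{Pos}_{\mathcal{F}}(t_0)$ and $B_i=(B_{i-1}\setminus\{q\in B_{i-1}\mid q\ge p_i\})\cup\{p_iq\mid q\in\mathrm{Pos}_{\mathcal{F}}(r_i)\}\cup\{p_ip'q\mid p_ipq\in B_{i-1},\ p\in\mathrm{Pos}_{\mathcal{V}}(l_i),\ l_i|_p=r_i|_{p'}\}$. The sequence is EV-safe if $p_i\in B_{i-1}$ for all $i$; write $s\to^*_{\mathrm{evs},S}t$ if there is a finite EV-safe sequence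 from $s$ to $t$. A transformation $U\in\{\mathbb{U},\mathbb{U}_{\mathrm{opt}}\}$ is sound for $R$ over $\mathcal{F}$ if for all $s,t\in T(\mathcal{F},\mathcal{V})$, $s\to^*_{U(R)}t$ implies $s\to^*_Rt$; it is sound for $R$ w.r.t. EV-safe reduction if for all $s,t\in T(\mathcal{F},\mathcal{V})$, $s\to^*_{\mathrm{evs},U(R)}t$ implies $s\to^*_Rt$. -}

module Defs where

open import Data.Nat using (ℕ; zero; suc; _∸_; _⊔_; _≟_)
open import Data.List using (List; []; _∷_; _++_; length; filter; upTo; foldr; concatMap; take; drop; map)
open import Data.List.Relation.Unary.All using (All)
open import Data.List.Membership.Propositional using (_∈_)
open import Data.List.Membership.DecPropositional _≟_ using (_∈?_)
open import Data.List.Relation.Binary.Subset.Propositional using (_⊆_)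
open import Data.Maybe using (Maybe; just; nothing)
open import Data.Product using (Σ; Σ-syntax; _×_; _,_; proj₁; proj₂)
open import Data.Sum using (_⊎_)
open import Data.Empty using (⊥)
open import Data.Unit using (⊤)
open import Relation.Nullary using (¬_)
open import Relation.Binary.PropositionalEquality using (_≡_)
open import Relation.Binary.Construct.Closure.ReflexiveTransitive using (Star)

-- Terms are unranked first-order terms over a symbol set G; arities of the
-- base signature F are enforced separately by the predicate WF.

data Term (G : Set) : Set where
  var : ℕ → Term G
  fun : G → List (Term G) → Term G

-- positions: lists of (0-based) argument indices
Pos : Set
Pos = List ℕ

_≤ₚ_ : Pos → Pos → Set
p ≤ₚ q = Σ Pos λ r → q ≡ p ++ r

Subst : Set → Set
Subst G = ℕ → Term G

module _ {G : Set} where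

  mutual
    _⟨_⟩ : Term G → Subst G → Term G
    var x ⟨ σ ⟩ = σ x
    fun f ts ⟨ σ ⟩ = fun f (ts ⟨ σ ⟩*)

    _⟨_⟩* : List (Term G) → Subst G → List (Term G)
    [] ⟨ σ ⟩* = []
    (t ∷ ts) ⟨ σ ⟩* = (t ⟨ σ ⟩) ∷ (ts ⟨ σ ⟩*)

  -- Var(t), as a list (possibly with repetitions)
  mutual
    vars : Term G → List ℕ
    vars (var x) = x ∷ []
    vars (fun f ts) = vars* ts

    vars* : List (Term G) → List ℕ
    vars* [] = []
    vars* (t ∷ ts) = vars t ++ vars* ts

  mutual
    _at_ : Term G → Pos → Maybe (Term G)
    t at [] = just t
    var x at (i ∷ p) = nothing
    fun f ts at (i ∷ p) = atList ts i p

    atList : List (Term G) → ℕ → Pos → Maybe (Term G)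
    atList [] i p = nothing
    atList (t ∷ ts) zero p = t at p
    atList (t ∷ ts) (suc i) p = atList ts i p

  PosF : Term G → Pos → Set
  PosF t p = Σ G λ f → Σ (List (Term G)) λ ts → t at p ≡ just (fun f ts)

  PosV : Term G → Pos → Set
  PosV t p = Σ ℕ λ x → t at p ≡ just (var x)

  mutual
    data CtxAt (Root : Term G → Term G → Set) : Pos → Term G → Term G → Set where
      top : ∀ {s t} → Root s t → CtxAt Root [] s t
      arg : ∀ {f ss ts i p} → ArgAt Root i p ss ts → CtxAt Root (i ∷ p) (fun f ss) (fun f ts)

    data ArgAt (Root : Term G → Term G → Set) : ℕ → Pos → List (Term G) → List (Term G) → Set where
      here  : ∀ {p s t ss} → CtxAt Root p s t → ArgAt Root zero p (s ∷ ss) (t ∷ ss)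
      there : ∀ {i p u ss ts} → ArgAt Root i p ss ts → ArgAt Root (suc i) p (u ∷ ss) (u ∷ ts)

  -- Unconditional rules / eTRSs (extra variables allowed; lhs may be a variable)

  TRule : Set
  TRule = Term G × Term G

  data TRoot (l r : Term G) : Term G → Term G → Set where
    mk : (σ : Subst G) → TRoot l r (l ⟨ σ ⟩) (r ⟨ σ ⟩)

  StepAt : Term G → Term G → Pos → Term G → Term G → Set
  StepAt l r = CtxAt (TRoot l r)

  TStep : (TRule → Set) → Term G → Term G → Set
  TStep S s t = Σ Pos λ p → Σ (Term G) λ l → Σ (Term G) λ r → S (l , r) × StepAt l r p s t

  nextB : (Pos → Set) → Pos → Term G → Term G → Pos → Set
  nextB B p l r q =
      (B q × ¬ (p ≤ₚ q))
    ⊎ (Σ Pos λ q' → q ≡ p ++ q' × PosF r q')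
    ⊎ (Σ Pos λ p' → Σ Pos λ pp → Σ Pos λ q' →
          q ≡ p ++ p' ++ q' × B (p ++ pp ++ q') × PosV l pp × l at pp ≡ r at p')

  -- EVS S B s t : an EV-safe sequence from s to t whose current set is B
  data EVS (S : TRule → Set) : (Pos → Set) → Term G → Term G → Set₁ where
    done : ∀ {B t} → EVS S B t t
    step : ∀ {B s u t p l r} → S (l , r) → B p → StepAt l r p s u →
           EVS S (nextB B p l r) u t → EVS S B s t

  _⊢_→evs*_ : (TRule → Set) → Term G → Term G → Set₁
  S ⊢ s →evs* t = EVS S (PosF s) s t

module _ {F : Set} (ar : F → ℕ) where
  mutual
    WF : Term F → Set
    WF (var x) = ⊤
    WF (fun f ts) = length ts ≡ ar f × WF* ts

    WF* : List (Term F) → Set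
    WF* [] = ⊤
    WF* (t ∷ ts) = WF t × WF* ts

record Rule (F : Set) : Set where
  constructor _⇒_⇐_
  field
    lhs   : Term F
    rhs   : Term F
    conds : List (Term F × Term F)   -- s₁ ↠ t₁ ; … ; sₖ ↠ tₖ
open Rule public

module _ {F : Set} where

  WFRule : (F → ℕ) → Rule F → Set
  WFRule ar ρ = WF ar (lhs ρ) × WF ar (rhs ρ) × All (λ c → WF ar (proj₁ c) × WF ar (proj₂ c)) (conds ρ)

  DetFrom : List ℕ → List (Term F × Term F) → Set
  DetFrom acc [] = ⊤
  DetFrom acc ((s , t) ∷ cs) = (vars s ⊆ acc) × DetFrom (acc ++ vars t) cs

  Deterministic : Rule F → Set
  Deterministic ρ = DetFrom (vars (lhs ρ)) (conds ρ)

  data CRoot (R : Rule F → Set) (Prev : Term F → Term F → Set) : Term F → Term F → Set where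
    mk : ∀ {ρ} (σ : Subst F) → R ρ →
         All (λ c → Prev (proj₁ c ⟨ σ ⟩) (proj₂ c ⟨ σ ⟩)) (conds ρ) →
         CRoot R Prev (lhs ρ ⟨ σ ⟩) (rhs ρ ⟨ σ ⟩)

  StepN : (Rule F → Set) → ℕ → Term F → Term F → Set
  StepN R zero s t = ⊥
  StepN R (suc n) s t = Σ Pos λ p → CtxAt (CRoot R (Star (StepN R n))) p s t

  CStep : (Rule F → Set) → Term F → Term F → Set
  CStep R s t = Σ ℕ λ n → StepN R n s t

-- extended signature: F together with the fresh symbols U^ρ_i (i ≥ 1)
data ExtSym (F : Set) : Set where
  orig : F → ExtSym F
  U    : Rule F → ℕ → ExtSym F

mutual
  emb : {F : Set} → Term F → Term (ExtSym F)
  emb (var x) = var x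
  emb (fun f ts) = fun (orig f) (emb* ts)

  emb* : {F : Set} → List (Term F) → List (Term (ExtSym F))
  emb* [] = []
  emb* (t ∷ ts) = emb t ∷ emb* ts

-- a finite set of variables listed in the fixed (increasing) order, without repetitions
ordered : List ℕ → List ℕ
ordered xs = filter (_∈? xs) (upTo (suc (foldr _⊔_ 0 xs)))

module _ {F : Set} where

  pairVars : Term F × Term F → List ℕ
  pairVars (s , t) = vars s ++ vars t

  -- X_i = Var(l, t₁, …, tᵢ₋₁)   (i ≥ 1)
  Xvars : Rule F → ℕ → List ℕ
  Xvars ρ i = vars (lhs ρ) ++ concatMap (λ c → vars (proj₂ c)) (take (i ∸ 1) (conds ρ))

  -- Y_i = Var(r, tᵢ, sᵢ₊₁, tᵢ₊₁, …, sₖ, tₖ)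
  yFrom : List (Term F × Term F) → List ℕ
  yFrom [] = []
  yFrom ((s , t) ∷ cs) = vars t ++ concatMap pairVars cs

  Yvars : Rule F → ℕ → List ℕ
  Yvars ρ i = vars (rhs ρ) ++ yFrom (drop (i ∸ 1) (conds ρ))

  -- the ordered lists  →X_i  and  →Z_i  (Z_i = X_i ∩ Y_i)
  Xlist : Rule F → ℕ → List ℕ
  Xlist ρ i = ordered (Xvars ρ i)

  Zlist : Rule F → ℕ → List ℕ
  Zlist ρ i = filter (_∈? Yvars ρ i) (Xlist ρ i)

  -- generic unraveling of one rule, parametrised by the choice of variable
  -- lists (Xlist for 𝕌, Zlist for 𝕌_opt)
  unravelFrom : (Rule F → ℕ → List ℕ) → (ρ : Rule F) → ℕ → Term (ExtSym F) →
                List (Term F × Term F) → List (TRule {ExtSym F})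
  unravelFrom V ρ i L [] = (L , emb (rhs ρ)) ∷ []
  unravelFrom V ρ i L ((s , t) ∷ cs) =
    (L , fun (U ρ i) (emb s ∷ map var (V ρ i)))
      ∷ unravelFrom V ρ (suc i) (fun (U ρ i) (emb t ∷ map var (V ρ i))) cs

  unravelRule : (Rule F → ℕ → List ℕ) → Rule F → List (TRule {ExtSym F})
  unravelRule V ρ = unravelFrom V ρ 1 (emb (lhs ρ)) (conds ρ)

  𝕌 : (Rule F → Set) → TRule {ExtSym F} → Set
  𝕌 R lr = Σ (Rule F) λ ρ → R ρ × lr ∈ unravelRule Xlist ρ

  𝕌opt : (Rule F → Set) → TRule {ExtSym F} → Set
  𝕌opt R lr = Σ (Rule F) λ ρ → R ρ × lr ∈ unravelRule Zlist ρ

  Sound : (F → ℕ) → ((Rule F → Set) → TRule {ExtSym F} → Set) → (Rule F → Set) → Set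
  Sound ar 𝒰 R = ∀ s t → WF ar s → WF ar t →
    Star (TStep (𝒰 R)) (emb s) (emb t) → Star (CStep R) s t

  SoundEVS : (F → ℕ) → ((Rule F → Set) → TRule {ExtSym F} → Set) → (Rule F → Set) → Set₁
  SoundEVS ar 𝒰 R = ∀ s t → WF ar s → WF ar t →
    (𝒰 R) ⊢ emb s →evs* emb t → Star (CStep R) s t

  IsEDCTRS : (F → ℕ) → (Rule F → Set) → Set
  IsEDCTRS ar R = ∀ ρ → R ρ → WFRule ar ρ × Deterministic ρ

module Submission where

-- Proof idea.  𝕌(R) and 𝕌_opt(R) differ only in which variables the
-- U-symbols carry: U^ρ_i(t, X⃗_i) versus U^ρ_i(t, Z⃗_i) with Z_i ⊆ X_i.  Let
-- "erase" be the map on terms that deletes, below every U^ρ_i, the arguments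
-- for variables of X_i ∖ Y_i.  Erasure fixes every term over F, sends each
-- rule of 𝕌(R) to the corresponding rule of 𝕌_opt(R), and commutes with
-- substitution, so it maps every 𝕌(R)-step either to an identity (when the
-- redex lies inside a deleted argument) or to a 𝕌_opt(R)-step.  Hence
-- emb s →*_𝕌(R) emb t implies emb s →*_𝕌opt(R) emb t, and (a) follows.
-- For (b) we additionally track the EV-safe position sets: the positions of
-- a term that survive erasure, restricted to B, are mapped into the set B'
-- of the erased sequence.  This invariant is preserved because a variable
-- of X_i that reappears at a surviving position of a right-hand side lies in
-- Y_i and hence at a surviving position of the left-hand side.

open import Defs
open import Data.Nat using (ℕ; zero; suc; _≟_)
open import Data.Bool using (Bool; true; false)
open import Data.List using (List; []; _∷_; _++_; map; filter; drop; concatMap)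
open import Data.List.Properties using (++-identityʳ-unique)
open import Data.List.Membership.Propositional using (_∈_)
open import Data.List.Membership.Propositional.Properties using (∈-++⁺ˡ; ∈-++⁺ʳ)
open import Data.List.Membership.DecPropositional _≟_ using (_∈?_)
open import Data.List.Relation.Unary.Any using (here; there)
open import Data.List.Relation.Binary.Subset.Propositional using (_⊆_)
open import Data.List.Relation.Binary.Subset.Propositional.Properties using (++⁺ʳ; ++⁺ˡ; xs⊆ys++xs)
open import Data.Maybe using (just)
open import Data.Product using (Σ; _×_; _,_; proj₂)
open import Data.Sum using (_⊎_; inj₁; inj₂)
open import Data.Empty using (⊥-elim)
open import Relation.Nullary using (¬_; yes; no; does)
open import Relation.Binary.PropositionalEquality
open import Relation.Binary.Construct.Closure.ReflexiveTransitive using (Star; ε; _◅_; _◅◅_)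

-- Argument masks

-- Keep the arguments marked 'true'; arguments beyond the mask are kept.
select : {A : Set} → List Bool → List A → List A
select [] xs = xs
select (b ∷ m) [] = []
select (true ∷ m) (x ∷ xs) = x ∷ select m xs
select (false ∷ m) (x ∷ xs) = select m xs

-- Kept m i j : under the mask m, argument i is kept and becomes argument j.
data Kept : List Bool → ℕ → ℕ → Set where
  beyond     : ∀ {i} → Kept [] i i
  keep-here  : ∀ {m} → Kept (true ∷ m) zero zero
  keep-later : ∀ {m i j} → Kept m i j → Kept (true ∷ m) (suc i) (suc j)
  skip-later : ∀ {m i j} → Kept m i j → Kept (false ∷ m) (suc i) j

data Dropped : List Bool → ℕ → Set where
  drop-here  : ∀ {m} → Dropped (false ∷ m) zero
  drop-later : ∀ {b m i} → Dropped m i → Dropped (b ∷ m) (suc i)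

kept-or-dropped : ∀ m i → (Σ ℕ λ j → Kept m i j) ⊎ Dropped m i
kept-or-dropped [] i = inj₁ (i , beyond)
kept-or-dropped (true ∷ m) zero = inj₁ (zero , keep-here)
kept-or-dropped (false ∷ m) zero = inj₂ drop-here
kept-or-dropped (b ∷ m) (suc i) with kept-or-dropped m i | b
... | inj₁ (j , k) | true  = inj₁ (suc j , keep-later k)
... | inj₁ (j , k) | false = inj₁ (j , skip-later k)
... | inj₂ d       | _     = inj₂ (drop-later d)

kept-not-dropped : ∀ {m i j} → Kept m i j → ¬ Dropped m i
kept-not-dropped (keep-later k) (drop-later d) = kept-not-dropped k d
kept-not-dropped (skip-later k) (drop-later d) = kept-not-dropped k d

kept-injective : ∀ {m i i' j} → Kept m i j → Kept m i' j → i ≡ i'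
kept-injective beyond beyond = refl
kept-injective keep-here keep-here = refl
kept-injective (keep-later k) (keep-later k') = cong suc (kept-injective k k')
kept-injective (skip-later k) (skip-later k') = cong suc (kept-injective k k')

kept-functional : ∀ {m i j j'} → Kept m i j → Kept m i j' → j ≡ j'
kept-functional beyond beyond = refl
kept-functional keep-here keep-here = refl
kept-functional (keep-later k) (keep-later k') = cong suc (kept-functional k k')
kept-functional (skip-later k) (skip-later k') = kept-functional k k'

module Erasure {G : Set} (mask : G → List Bool) where

  mutual
    erase : Term G → Term G
    erase (var x) = var x
    erase (fun g ts) = fun g (select (mask g) (erase* ts))

    erase* : List (Term G) → List (Term G)
    erase* [] = []
    erase* (t ∷ ts) = erase t ∷ erase* ts

  select-subst : ∀ m (xs : List (Term G)) (τ : Subst G) → select m (xs ⟨ τ ⟩*) ≡ select m xs ⟨ τ ⟩*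
  select-subst [] xs τ = refl
  select-subst (b ∷ m) [] τ = refl
  select-subst (true ∷ m) (x ∷ xs) τ = cong (_ ∷_) (select-subst m xs τ)
  select-subst (false ∷ m) (x ∷ xs) τ = select-subst m xs τ

  mutual
    erase-subst : ∀ (t : Term G) σ → erase (t ⟨ σ ⟩) ≡ erase t ⟨ (λ x → erase (σ x)) ⟩
    erase-subst (var x) σ = refl
    erase-subst (fun g ts) σ = cong (fun g) (begin
      select (mask g) (erase* (ts ⟨ σ ⟩*))  ≡⟨ cong (select (mask g)) (erase*-subst ts σ) ⟩
      select (mask g) (erase* ts ⟨ _ ⟩*)    ≡⟨ select-subst (mask g) (erase* ts) _ ⟩
      select (mask g) (erase* ts) ⟨ _ ⟩*    ∎)
      where open ≡-Reasoning

    erase*-subst : ∀ (ts : List (Term G)) σ → erase* (ts ⟨ σ ⟩*) ≡ erase* ts ⟨ (λ x → erase (σ x)) ⟩*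
    erase*-subst [] σ = refl
    erase*-subst (t ∷ ts) σ = cong₂ _∷_ (erase-subst t σ) (erase*-subst ts σ)

  erase-root : ∀ l r {a b} → TRoot l r a b → TRoot (erase l) (erase r) (erase a) (erase b)
  erase-root l r (mk σ) = subst₂ (TRoot (erase l) (erase r)) (sym (erase-subst l σ)) (sym (erase-subst r σ)) (mk _)

  -- Surviving positions

  -- Survives t p p' : the position p of t is not inside a deleted argument
  -- and corresponds to the position p' of erase t.
  mutual
    data Survives : Term G → Pos → Pos → Set where
      root : ∀ {t} → Survives t [] []
      sub  : ∀ {g ts i j p p'} → Kept (mask g) i j → Survives* ts i p p' → Survives (fun g ts) (i ∷ p) (j ∷ p')

    data Survives* : List (Term G) → ℕ → Pos → Pos → Set where
      hd : ∀ {t ts p p'} → Survives t p p' → Survives* (t ∷ ts) zero p p'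
      tl : ∀ {t ts i p p'} → Survives* ts i p p' → Survives* (t ∷ ts) (suc i) p p'

  select-at : ∀ {m i j} (xs : List (Term G)) q → Kept m i j → atList (select m xs) j q ≡ atList xs i q
  select-at xs q beyond = refl
  select-at [] q keep-here = refl
  select-at (x ∷ xs) q keep-here = refl
  select-at [] q (keep-later k) = refl
  select-at (x ∷ xs) q (keep-later k) = select-at xs q k
  select-at [] q (skip-later k) = refl
  select-at (x ∷ xs) q (skip-later k) = select-at xs q k

  mutual
    erase-at : ∀ {t p p' v} → Survives t p p' → t at p ≡ just v → erase t at p' ≡ just (erase v)
    erase-at root refl = refl
    erase-at {fun g ts} (sub {p' = p'} k c) e = trans (select-at (erase* ts) p' k) (erase*-at c e)

    erase*-at : ∀ {ts i p p' v} → Survives* ts i p p' → atList ts i p ≡ just v → atList (erase* ts) i p' ≡ just (erase v)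
    erase*-at (hd c) e = erase-at c e
    erase*-at (tl c) e = erase*-at c e

  mutual
    survives-split : ∀ {t} p {q q' t₀} → Survives t (p ++ q) q' → t at p ≡ just t₀ →
                     Σ Pos λ p' → Σ Pos λ q₀ → Survives t p p' × q' ≡ p' ++ q₀ × Survives t₀ q q₀
    survives-split [] c refl = [] , _ , root , refl , c
    survives-split {var x} (i ∷ p) c ()
    survives-split {fun g ts} (i ∷ p) (sub k c) e with survives*-split p c e
    ... | p' , q₀ , c₁ , refl , c₂ = _ ∷ p' , q₀ , sub k c₁ , refl , c₂

    survives*-split : ∀ {ts i} p {q q' t₀} → Survives* ts i (p ++ q) q' → atList ts i p ≡ just t₀ →
                      Σ Pos λ p' → Σ Pos λ q₀ → Survives* ts i p p' × q' ≡ p' ++ q₀ × Survives t₀ q q₀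
    survives*-split p (hd c) e with survives-split p c e
    ... | p' , q₀ , c₁ , eq , c₂ = p' , q₀ , hd c₁ , eq , c₂
    survives*-split p (tl c) e with survives*-split p c e
    ... | p' , q₀ , c₁ , eq , c₂ = p' , q₀ , tl c₁ , eq , c₂

  mutual
    survives-join : ∀ {t p p' t₀ q q'} → Survives t p p' → t at p ≡ just t₀ → Survives t₀ q q' →
                    Survives t (p ++ q) (p' ++ q')
    survives-join root refl c = c
    survives-join {fun g ts} (sub k c) e c₀ = sub k (survives*-join c e c₀)

    survives*-join : ∀ {ts i p p' t₀ q q'} → Survives* ts i p p' → atList ts i p ≡ just t₀ → Survives t₀ q q' →
                     Survives* ts i (p ++ q) (p' ++ q')
    survives*-join (hd c) e c₀ = hd (survives-join c e c₀)
    survives*-join (tl c) e c₀ = tl (survives*-join c e c₀)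

  mutual
    survives-unique : ∀ {t p p₁ p₂} → Survives t p p₁ → Survives t p p₂ → p₁ ≡ p₂
    survives-unique root root = refl
    survives-unique (sub k c) (sub k' c') = cong₂ _∷_ (kept-functional k k') (survives*-unique c c')

    survives*-unique : ∀ {ts i p p₁ p₂} → Survives* ts i p p₁ → Survives* ts i p p₂ → p₁ ≡ p₂
    survives*-unique (hd c) (hd c') = survives-unique c c'
    survives*-unique (tl c) (tl c') = survives*-unique c c'

  mutual
    survives-reflects-≤ : ∀ {t p p' q q'} → Survives t p p' → Survives t q q' → p' ≤ₚ q' → p ≤ₚ q
    survives-reflects-≤ {q = q} root c le = q , refl
    survives-reflects-≤ (sub k c) root (r , ())
    survives-reflects-≤ (sub k c) (sub k' c') (r , refl) with kept-injective k k'
    ... | refl with survives*-reflects-≤ c c' (r , refl)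
    ...   | r' , e = r' , cong (_ ∷_) e

    survives*-reflects-≤ : ∀ {ts i p p' q q'} → Survives* ts i p p' → Survives* ts i q q' → p' ≤ₚ q' → p ≤ₚ q
    survives*-reflects-≤ (hd c) (hd c') le = survives-reflects-≤ c c' le
    survives*-reflects-≤ (tl c) (tl c') le = survives*-reflects-≤ c c' le

  mutual
    survives-unsubst : ∀ (t : Term G) {p p' v} σ → Survives (t ⟨ σ ⟩) p p' → t at p ≡ just v → Survives t p p'
    survives-unsubst t {[]} σ root e = root
    survives-unsubst (var x) {i ∷ p} σ c ()
    survives-unsubst (fun g ts) {i ∷ p} σ (sub k c) e = sub k (survives*-unsubst ts σ c e)

    survives*-unsubst : ∀ (ts : List (Term G)) {i p p' v} σ → Survives* (ts ⟨ σ ⟩*) i p p' → atList ts i p ≡ just v →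
                        Survives* ts i p p'
    survives*-unsubst [] σ () e
    survives*-unsubst (t ∷ ts) σ (hd c) e = hd (survives-unsubst t σ c e)
    survives*-unsubst (t ∷ ts) σ (tl c) e = tl (survives*-unsubst ts σ c e)

  mutual
    survives-subst : ∀ (t : Term G) {p p'} σ → Survives t p p' → Survives (t ⟨ σ ⟩) p p'
    survives-subst t σ root = root
    survives-subst (fun g ts) σ (sub k c) = sub k (survives*-subst ts σ c)

    survives*-subst : ∀ (ts : List (Term G)) {i p p'} σ → Survives* ts i p p' → Survives* (ts ⟨ σ ⟩*) i p p'
    survives*-subst (t ∷ ts) σ (hd c) = hd (survives-subst t σ c)
    survives*-subst (t ∷ ts) σ (tl c) = tl (survives*-subst ts σ c)

  mutual
    at-subst : ∀ (t : Term G) p {v} σ → t at p ≡ just v → (t ⟨ σ ⟩) at p ≡ just (v ⟨ σ ⟩)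
    at-subst t [] σ refl = refl
    at-subst (var x) (i ∷ p) σ ()
    at-subst (fun g ts) (i ∷ p) σ e = at*-subst ts i p σ e

    at*-subst : ∀ (ts : List (Term G)) i p {v} σ → atList ts i p ≡ just v → atList (ts ⟨ σ ⟩*) i p ≡ just (v ⟨ σ ⟩)
    at*-subst [] i p σ ()
    at*-subst (t ∷ ts) zero p σ e = at-subst t p σ e
    at*-subst (t ∷ ts) (suc i) p σ e = at*-subst ts i p σ e

  NotStrictlyBelow : Pos → Pos → Set
  NotStrictlyBelow p q = ∀ r → q ≡ p ++ r → r ≡ []

  not-prefix⇒not-strictly-below : ∀ {p q} → ¬ (p ≤ₚ q) → NotStrictlyBelow p q
  not-prefix⇒not-strictly-below p≰q r e = ⊥-elim (p≰q (r , e))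

  not-strictly-below-refl : ∀ p → NotStrictlyBelow p p
  not-strictly-below-refl p r e = ++-identityʳ-unique p e

  mutual
    survives-before-step : ∀ {Root : Term G → Term G → Set} {p s u q q'} → CtxAt Root p s u →
                           Survives u q q' → NotStrictlyBelow p q → Survives s q q'
    survives-before-step (top _) root _ = root
    survives-before-step (top _) (sub k c) nb with nb _ refl
    ... | ()
    survives-before-step (arg _) root _ = root
    survives-before-step (arg a) (sub k c) nb = sub k (survives*-before-step a c nb)

    survives*-before-step : ∀ {Root : Term G → Term G → Set} {i p ss ts i' q q'} → ArgAt Root i p ss ts →
                            Survives* ts i' q q' → NotStrictlyBelow (i ∷ p) (i' ∷ q) → Survives* ss i' q q'
    survives*-before-step (here x) (hd c) nb = hd (survives-before-step x c (λ r e → nb r (cong (_ ∷_) e)))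
    survives*-before-step (here _) (tl c) _ = tl c
    survives*-before-step (there _) (hd c) _ = hd c
    survives*-before-step (there a) (tl c) nb = tl (survives*-before-step a c (λ { r refl → nb r refl }))

  mutual
    redex-at : ∀ {Root : Term G → Term G → Set} {p s u} → CtxAt Root p s u →
               Σ (Term G) λ s₀ → Σ (Term G) λ u₀ → s at p ≡ just s₀ × u at p ≡ just u₀ × Root s₀ u₀
    redex-at (top x) = _ , _ , refl , refl , x
    redex-at (arg a) = redex*-at a

    redex*-at : ∀ {Root : Term G → Term G → Set} {i p ss ts} → ArgAt Root i p ss ts →
                Σ (Term G) λ s₀ → Σ (Term G) λ u₀ → atList ss i p ≡ just s₀ × atList ts i p ≡ just u₀ × Root s₀ u₀
    redex*-at (here x) = redex-at x
    redex*-at (there a) = redex*-at a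

  select-step : ∀ {Root : Term G → Term G → Set} {m i j p xs ys} → Kept m i j → ArgAt Root i p xs ys →
                ArgAt Root j p (select m xs) (select m ys)
  select-step beyond a = a
  select-step keep-here (here x) = here x
  select-step (keep-later k) (there a) = there (select-step k a)
  select-step (skip-later k) (there a) = select-step k a

  select-dropped-step : ∀ {Root : Term G → Term G → Set} {m i p ss ts} → ArgAt Root i p ss ts → Dropped m i →
                        select m (erase* ss) ≡ select m (erase* ts)
  select-dropped-step (here x) drop-here = refl
  select-dropped-step {m = true ∷ m} (there a) (drop-later d) = cong (_ ∷_) (select-dropped-step a d)
  select-dropped-step {m = false ∷ m} (there a) (drop-later d) = select-dropped-step a d

  data ErasedStep (Root' : Term G → Term G → Set) (p : Pos) (s u : Term G) : Set where
    invisible : erase s ≡ erase u → (∀ {p'} → ¬ Survives s p p') → ErasedStep Root' p s u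
    visible   : ∀ {p'} → Survives s p p' → CtxAt Root' p' (erase s) (erase u) → ErasedStep Root' p s u

  data ErasedArgStep (Root' : Term G → Term G → Set) (i : ℕ) (p : Pos) (ss ts : List (Term G)) : Set where
    invisible : erase* ss ≡ erase* ts → (∀ {p'} → ¬ Survives* ss i p p') → ErasedArgStep Root' i p ss ts
    visible   : ∀ {p'} → Survives* ss i p p' → ArgAt Root' i p' (erase* ss) (erase* ts) → ErasedArgStep Root' i p ss ts

  module _ {Root Root' : Term G → Term G → Set} (erase-Root : ∀ {a b} → Root a b → Root' (erase a) (erase b)) where
    mutual
      erase-step : ∀ {p s u} → CtxAt Root p s u → ErasedStep Root' p s u
      erase-step (top x) = visible root (top (erase-Root x))
      erase-step (arg {f = f} {i = i} a) with erase-arg-step a | kept-or-dropped (mask f) i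
      ... | invisible e gone | _ =
        invisible (cong (λ z → fun f (select (mask f) z)) e) λ { (sub k c) → gone c }
      ... | visible c a' | inj₁ (j , k) = visible (sub k c) (arg (select-step k a'))
      ... | visible _ _  | inj₂ d =
        invisible (cong (fun f) (select-dropped-step a d)) λ { (sub k c) → kept-not-dropped k d }

      erase-arg-step : ∀ {i p ss ts} → ArgAt Root i p ss ts → ErasedArgStep Root' i p ss ts
      erase-arg-step (here x) with erase-step x
      ... | invisible e gone = invisible (cong₂ _∷_ e refl) λ { (hd c) → gone c }
      ... | visible c x' = visible (hd c) (here x')
      erase-arg-step (there a) with erase-arg-step a
      ... | invisible e gone = invisible (cong (_ ∷_) e) λ { (tl c) → gone c }
      ... | visible c a' = visible (tl c) (there a')

  through-contractum : ∀ {l r p p' s u q q'} → StepAt l r p s u → Survives s p p' → Survives u (p ++ q) q' →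
                       Σ (Subst G) λ σ → Σ Pos λ q₀ → q' ≡ p' ++ q₀ × Survives (r ⟨ σ ⟩) q q₀ × s at p ≡ just (l ⟨ σ ⟩)
  through-contractum {p = p} st cp cq with redex-at st
  ... | _ , _ , e₁ , e₂ , mk σ with survives-split p cq e₂
  ... | p'' , q₀ , c₁ , refl , c₂ with survives-unique cp (survives-before-step st c₁ (not-strictly-below-refl p))
  ... | refl = σ , q₀ , refl , c₂ , e₁

  contractum-needs-redex : ∀ {l r p s u q q'} → StepAt l r p s u → Survives u (p ++ q) q' → Σ Pos λ p' → Survives s p p'
  contractum-needs-redex {p = p} st cq with redex-at st
  ... | _ , _ , _ , e₂ , _ with survives-split p cq e₂
  ... | p' , _ , c₁ , _ , _ = p' , survives-before-step st c₁ (not-strictly-below-refl p)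

  -- Erasure of EV-safe sequences

  ErasureSafe : Term G → Term G → Set
  ErasureSafe l r = ∀ {x pp p₁ p₁'} → l at pp ≡ just (var x) → r at p₁ ≡ just (var x) →
                    Survives r p₁ p₁' → Σ Pos λ pp' → Survives l pp pp'

  Covers : (Pos → Set) → (Pos → Set) → Term G → Set
  Covers B B' s = ∀ {q q'} → Survives s q q' → B q → B' q'

  covers-visible-step : ∀ {B B' p p' l r s u} → ErasureSafe l r → Covers B B' s → StepAt l r p s u → Survives s p p' →
                        Covers (nextB B p l r) (nextB B' p' (erase l) (erase r)) u
  covers-visible-step {s = s} _ cover st cp {q} {q'} cq (inj₁ (bq , p≰q)) =
    inj₁ (cover cq-before bq , λ p'≤q' → p≰q (survives-reflects-≤ cp cq-before p'≤q'))
    where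
      cq-before : Survives s q q'
      cq-before = survives-before-step st cq (not-prefix⇒not-strictly-below p≰q)
  covers-visible-step {r = r} _ _ st cp cq (inj₂ (inj₁ (q₀ , refl , (g , ts , e)))) with through-contractum st cp cq
  ... | σ , q₀' , refl , c , _ = inj₂ (inj₁ (q₀' , refl , (g , _ , erase-at (survives-unsubst r σ c e) e)))
  covers-visible-step {l = l} {r = r} safe cover st cp cq (inj₂ (inj₂ (p₁ , pp , q₁ , refl , bq , (x , ex) , l≡r)))
    with through-contractum st cp cq | trans (sym l≡r) ex
  ... | σ , w , refl , c , e₁ | er with survives-split p₁ c (at-subst r p₁ σ er)
  ... | p₁' , q₁' , c₁ , refl , c₂ with safe ex er (survives-unsubst r σ c₁ er)
  ... | pp' , cl =
    inj₂ (inj₂ (p₁' , pp' , q₁' , refl ,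
      cover (survives-join cp e₁ (survives-join (survives-subst l σ cl) (at-subst l pp σ ex) c₂)) bq ,
      (x , erase-at cl ex) , trans (erase-at cl ex) (sym (erase-at (survives-unsubst r σ c₁ er) er))))

  covers-invisible-step : ∀ {B B' p l r s u} → Covers B B' s → StepAt l r p s u → (∀ {p'} → ¬ Survives s p p') →
                          Covers (nextB B p l r) B' u
  covers-invisible-step cover st _ cq (inj₁ (bq , p≰q)) =
    cover (survives-before-step st cq (not-prefix⇒not-strictly-below p≰q)) bq
  covers-invisible-step _ st gone cq (inj₂ (inj₁ (_ , refl , _))) = ⊥-elim (gone (proj₂ (contractum-needs-redex st cq)))
  covers-invisible-step _ st gone cq (inj₂ (inj₂ (_ , _ , _ , refl , _))) = ⊥-elim (gone (proj₂ (contractum-needs-redex st cq)))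

  covers-initial : ∀ s → Covers (PosF s) (PosF (erase s)) s
  covers-initial s c (g , ts , e) = g , _ , erase-at c e

  module Simulation (S S' : TRule {G} → Set)
                    (erase-rule : ∀ {l r} → S (l , r) → S' (erase l , erase r))
                    (safe : ∀ {l r} → S (l , r) → ErasureSafe l r) where

    -- Covering is exactly the invariant making each erased step EV-safe.
    erase-evs : ∀ {B B' s t} → Covers B B' s → EVS S B s t → EVS S' B' (erase s) (erase t)
    erase-evs cover done = done
    erase-evs cover (step {l = l} {r = r} Slr bp st rest) with erase-step (erase-root l r) st
    ... | invisible e gone = subst (λ z → EVS S' _ z _) (sym e) (erase-evs (covers-invisible-step cover st gone) rest)
    ... | visible cp st' = step (erase-rule Slr) (cover cp bp) st' (erase-evs (covers-visible-step (safe Slr) cover st cp) rest)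

    erase-tstep : ∀ {s u} → TStep S s u → Star (TStep S') (erase s) (erase u)
    erase-tstep (p , l , r , Slr , st) with erase-step (erase-root l r) st
    ... | invisible e _ = subst (Star (TStep S') (erase _)) e ε
    ... | visible {p'} _ st' = (p' , erase l , erase r , erase-rule Slr , st') ◅ ε

    erase-star : ∀ {s t} → Star (TStep S) s t → Star (TStep S') (erase s) (erase t)
    erase-star ε = ε
    erase-star (x ◅ xs) = erase-tstep x ◅◅ erase-star xs

    erase-evs* : ∀ {s t} → S ⊢ s →evs* t → S' ⊢ erase s →evs* erase t
    erase-evs* {s} = erase-evs (covers-initial s)

drop-suc : ∀ {A : Set} i (xs : List A) {y ys} → drop i xs ≡ y ∷ ys → drop (suc i) xs ≡ ys
drop-suc zero (x ∷ xs) refl = refl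
drop-suc (suc i) (x ∷ xs) e = drop-suc i xs e
drop-suc (suc i) [] ()

-- Erasure for the unravelings: from 𝕌(R) to 𝕌_opt(R)

module _ {F : Set} where

  -- Below U^ρ_i keep the first argument and exactly the variables of X⃗_i
  -- that lie in Y_i (so X⃗_i becomes Z⃗_i); symbols of F keep everything.
  inY : Rule F → ℕ → List ℕ → List Bool
  inY ρ i = map (λ x → does (x ∈? Yvars ρ i))

  unravelMask : ExtSym F → List Bool
  unravelMask (orig f) = []
  unravelMask (U ρ i) = true ∷ inY ρ i (Xlist ρ i)

  open Erasure unravelMask

  U-term : (Rule F → ℕ → List ℕ) → Rule F → ℕ → Term F → Term (ExtSym F)
  U-term V ρ i t = fun (U ρ i) (emb t ∷ map var (V ρ i))

  -- Terms over F have no U-symbols, so erasure fixes them.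
  mutual
    erase-emb : ∀ (t : Term F) → erase (emb t) ≡ emb t
    erase-emb (var x) = refl
    erase-emb (fun f ts) = cong (fun (orig f)) (erase*-emb ts)

    erase*-emb : ∀ (ts : List (Term F)) → erase* (emb* ts) ≡ emb* ts
    erase*-emb [] = refl
    erase*-emb (t ∷ ts) = cong₂ _∷_ (erase-emb t) (erase*-emb ts)

  erase*-vars : ∀ (X : List ℕ) → erase* (map var X) ≡ map var X
  erase*-vars [] = refl
  erase*-vars (x ∷ X) = cong (var x ∷_) (erase*-vars X)

  select-inY : ∀ ρ i (X : List ℕ) → select (inY ρ i X) (map {B = Term (ExtSym F)} var X) ≡ map var (filter (_∈? Yvars ρ i) X)
  select-inY ρ i [] = refl
  select-inY ρ i (x ∷ X) with does (x ∈? Yvars ρ i)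
  ... | true = cong (var x ∷_) (select-inY ρ i X)
  ... | false = select-inY ρ i X

  erase-U-term : ∀ ρ i (t : Term F) → erase (U-term Xlist ρ i t) ≡ U-term Zlist ρ i t
  erase-U-term ρ i t = cong (fun (U ρ i)) (cong₂ _∷_ (erase-emb t) (begin
    select (inY ρ i X) (erase* (map var X))  ≡⟨ cong (select (inY ρ i X)) (erase*-vars X) ⟩
    select (inY ρ i X) (map var X)           ≡⟨ select-inY ρ i X ⟩
    map var (Zlist ρ i)                      ∎))
    where
      open ≡-Reasoning
      X : List ℕ
      X = Xlist ρ i

  unravel-erase : ∀ ρ i L cs {l r} → (l , r) ∈ unravelFrom Xlist ρ i L cs →
                  (erase l , erase r) ∈ unravelFrom Zlist ρ i (erase L) cs
  unravel-erase ρ i L [] (here refl) = here (cong (erase L ,_) (erase-emb (rhs ρ)))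
  unravel-erase ρ i L ((s , t) ∷ cs) (here refl) = here (cong (erase L ,_) (erase-U-term ρ i s))
  unravel-erase ρ i L ((s , t) ∷ cs) {l} {r} (there m) =
    there (subst (λ z → (erase l , erase r) ∈ unravelFrom Zlist ρ (suc i) z cs) (erase-U-term ρ i t)
                 (unravel-erase ρ (suc i) _ cs m))

  erase-rule : ∀ {R : Rule F → Set} {l r} → 𝕌 R (l , r) → 𝕌opt R (erase l , erase r)
  erase-rule {l = l} {r} (ρ , Rρ , m) =
    ρ , Rρ , subst (λ z → (erase l , erase r) ∈ unravelFrom Zlist ρ 1 z (conds ρ)) (erase-emb (lhs ρ))
                   (unravel-erase ρ 1 _ (conds ρ) m)

  mutual
    survives-emb : ∀ (t : Term F) q {v} → emb t at q ≡ just v → Survives (emb t) q q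
    survives-emb t [] e = root
    survives-emb (var x) (i ∷ q) ()
    survives-emb (fun f ts) (i ∷ q) e = sub beyond (survives*-emb ts i q e)

    survives*-emb : ∀ (ts : List (Term F)) i q {v} → atList (emb* ts) i q ≡ just v → Survives* (emb* ts) i q q
    survives*-emb [] i q ()
    survives*-emb (t ∷ ts) zero q e = hd (survives-emb t q e)
    survives*-emb (t ∷ ts) (suc i) q e = tl (survives*-emb ts i q e)

  mutual
    emb-var : ∀ (t : Term F) q {x} → emb t at q ≡ just (var x) → x ∈ vars t
    emb-var (var y) [] refl = here refl
    emb-var (fun f ts) [] ()
    emb-var (var y) (i ∷ q) ()
    emb-var (fun f ts) (i ∷ q) e = emb*-var ts i q e

    emb*-var : ∀ (ts : List (Term F)) i q {x} → atList (emb* ts) i q ≡ just (var x) → x ∈ vars* ts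
    emb*-var [] i q ()
    emb*-var (t ∷ ts) zero q e = ∈-++⁺ˡ (emb-var t q e)
    emb*-var (t ∷ ts) (suc i) q e = ∈-++⁺ʳ (vars t) (emb*-var ts i q e)

  var-in-Y-kept : ∀ ρ i (X : List ℕ) k q {x} → atList (map {B = Term (ExtSym F)} var X) k q ≡ just (var x) →
                  x ∈ Yvars ρ i → Σ ℕ λ j → Kept (inY ρ i X) k j × Survives* (map var X) k q q
  var-in-Y-kept ρ i [] k q ()
  var-in-Y-kept ρ i (y ∷ X) zero [] refl x∈Y with y ∈? Yvars ρ i
  ... | yes _ = zero , keep-here , hd root
  ... | no x∉Y = ⊥-elim (x∉Y x∈Y)
  var-in-Y-kept ρ i (y ∷ X) zero (_ ∷ q) ()
  var-in-Y-kept ρ i (y ∷ X) (suc k) q e x∈Y with var-in-Y-kept ρ i X k q e x∈Y | does (y ∈? Yvars ρ i)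
  ... | j , kept , c | true = suc j , keep-later kept , tl c
  ... | j , kept , c | false = j , skip-later kept , tl c

  kept-var-in-Y : ∀ ρ i (X : List ℕ) k q {x j} → atList (map {B = Term (ExtSym F)} var X) k q ≡ just (var x) →
                  Kept (inY ρ i X) k j → x ∈ Yvars ρ i
  kept-var-in-Y ρ i [] k q ()
  kept-var-in-Y ρ i (y ∷ X) zero [] refl kept with y ∈? Yvars ρ i
  ... | yes y∈Y = y∈Y
  kept-var-in-Y ρ i (y ∷ X) zero [] refl () | no _
  kept-var-in-Y ρ i (y ∷ X) zero (_ ∷ q) ()
  kept-var-in-Y ρ i (y ∷ X) (suc k) q e kept with does (y ∈? Yvars ρ i)
  kept-var-in-Y ρ i (y ∷ X) (suc k) q e (keep-later kept) | true = kept-var-in-Y ρ i X k q e kept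
  kept-var-in-Y ρ i (y ∷ X) (suc k) q e (skip-later kept) | false = kept-var-in-Y ρ i X k q e kept

  U-term-surviving-var : ∀ ρ i (t : Term F) p {x p'} → U-term Xlist ρ i t at p ≡ just (var x) →
                         Survives (U-term Xlist ρ i t) p p' → x ∈ vars t ⊎ x ∈ Yvars ρ i
  U-term-surviving-var ρ i t [] () c
  U-term-surviving-var ρ i t (zero ∷ q) e c = inj₁ (emb-var t q e)
  U-term-surviving-var ρ i t (suc k ∷ q) e (sub (keep-later kept) (tl c)) = inj₂ (kept-var-in-Y ρ i (Xlist ρ i) k q e kept)

  U-term-keeps-Y : ∀ ρ i (t : Term F) p {x} → U-term Xlist ρ i t at p ≡ just (var x) → x ∈ Yvars ρ i →
                   Σ Pos λ p' → Survives (U-term Xlist ρ i t) p p'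
  U-term-keeps-Y ρ i t [] () x∈Y
  U-term-keeps-Y ρ i t (zero ∷ q) e x∈Y = zero ∷ q , sub keep-here (hd (survives-emb t q e))
  U-term-keeps-Y ρ i t (suc k ∷ q) e x∈Y with var-in-Y-kept ρ i (Xlist ρ i) k q e x∈Y
  ... | j , kept , c = suc j ∷ q , sub (keep-later kept) (tl c)

  Needed : Rule F → List (Term F × Term F) → List ℕ
  Needed ρ cs = vars (rhs ρ) ++ concatMap pairVars cs

  KeepsVars : Term (ExtSym F) → List ℕ → Set
  KeepsVars L Y = ∀ {pp x} → L at pp ≡ just (var x) → x ∈ Y → Σ Pos λ pp' → Survives L pp pp'

  -- If (s , t) ∷ cs are the conditions from s_{i+1} ↠ t_{i+1} on, then
  -- Y_{i+1} = Var(r, t, cs) lies between Needed ρ cs and Needed ρ ((s , t) ∷ cs).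
  Y⊆Needed : ∀ ρ i {s t cs} → drop i (conds ρ) ≡ (s , t) ∷ cs → Yvars ρ (suc i) ⊆ Needed ρ ((s , t) ∷ cs)
  Y⊆Needed ρ i {s} {t} {cs} d rewrite d = ++⁺ʳ (vars (rhs ρ)) (++⁺ˡ (concatMap pairVars cs) (xs⊆ys++xs (vars t) (vars s)))

  Needed⊆Y : ∀ ρ i {s t cs} → drop i (conds ρ) ≡ (s , t) ∷ cs → Needed ρ cs ⊆ Yvars ρ (suc i)
  Needed⊆Y ρ i {s} {t} {cs} d rewrite d = ++⁺ʳ (vars (rhs ρ)) (xs⊆ys++xs (concatMap pairVars cs) (vars t))

  unravel-safe : ∀ ρ i L cs → drop i (conds ρ) ≡ cs → KeepsVars L (Needed ρ cs) →
                 ∀ {l r} → (l , r) ∈ unravelFrom Xlist ρ (suc i) L cs → ErasureSafe l r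
  unravel-safe ρ i L [] _ keeps (here refl) {p₁ = p₁} ex er _ = keeps ex (∈-++⁺ˡ (emb-var (rhs ρ) p₁ er))
  unravel-safe ρ i L ((s , t) ∷ cs) d keeps (here refl) {p₁ = p₁} ex er c
    with U-term-surviving-var ρ (suc i) s p₁ er c
  ... | inj₁ x∈s = keeps ex (∈-++⁺ʳ (vars (rhs ρ)) (∈-++⁺ˡ (∈-++⁺ˡ x∈s)))
  ... | inj₂ x∈Y = keeps ex (Y⊆Needed ρ i d x∈Y)
  unravel-safe ρ i L ((s , t) ∷ cs) d keeps (there m) =
    unravel-safe ρ (suc i) _ cs (drop-suc i (conds ρ) d)
                 (λ {pp} ex x∈ → U-term-keeps-Y ρ (suc i) t pp ex (Needed⊆Y ρ i d x∈)) m

  -- Hence every rule of 𝕌(R) is erasure-safe: the left-hand side l of ρ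
  -- lies over F, so all of its positions survive.
  𝕌-safe : ∀ {R : Rule F → Set} {l r} → 𝕌 R (l , r) → ErasureSafe l r
  𝕌-safe (ρ , _ , m) = unravel-safe ρ 0 (emb (lhs ρ)) (conds ρ) refl (λ {pp} ex _ → pp , survives-emb (lhs ρ) pp ex) m

module _ {F : Set} (R : Rule F → Set) where
  open Erasure (unravelMask {F})
  open Simulation (𝕌 R) (𝕌opt R) erase-rule 𝕌-safe

  𝕌→𝕌opt : ∀ (s t : Term F) → Star (TStep (𝕌 R)) (emb s) (emb t) → Star (TStep (𝕌opt R)) (emb s) (emb t)
  𝕌→𝕌opt s t d = subst₂ (Star (TStep (𝕌opt R))) (erase-emb s) (erase-emb t) (erase-star d)

  𝕌→𝕌opt-evs : ∀ (s t : Term F) → 𝕌 R ⊢ emb s →evs* emb t → 𝕌opt R ⊢ emb s →evs* emb t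
  𝕌→𝕌opt-evs s t d = subst₂ (λ a b → 𝕌opt R ⊢ a →evs* b) (erase-emb s) (erase-emb t) (erase-evs* d)

-- Corollary 5.5.  Each soundness property of 𝕌_opt is applied to the
-- 𝕌_opt(R)-reduction obtained by erasure.
corollary5p5 : (F : Set) (ar : F → ℕ) (R : Rule F → Set) → IsEDCTRS ar R →
    (Sound ar 𝕌opt R → Sound ar 𝕌 R) × (SoundEVS ar 𝕌opt R → SoundEVS ar 𝕌 R)
corollary5p5 F ar R _ =
  (λ sound s t ws wt d → sound s t ws wt (𝕌→𝕌opt R s t d)) ,
  (λ sound s t ws wt d → sound s t ws wt (𝕌→𝕌opt-evs R s t d))
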